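{- Let $G$ be a connected word-representable graph with at least one edge, and let $w$ be a $k$-uniform word representing $G$, with permutations $P_1,\dots,P_k$. Then for all $i\neq j$ we have $l(P_i)\neq s(P_j)$, and for every $i$ we have $s(w)\neq l(P_i)$ and $l(w)\neq s(P_i)$.
   Context: A word $w$ over the alphabet $V$ represents the simple graph $G=(V,E)$ if every letter of $V$ occurs in $w$ and, for all distinct $x,y\in V$, $x$ and $y$ alternate in $w$ (deleting all other letters leaves $xyxy\cdots$ or $yxyx\cdots$) if and only if $xy\in E$. A word is $k$-uniform if every letter occurs exactly $k$ times. For a $k$-uniform word $w$ and $1\le i\le k$, the $i$-th permutation $P_i$ is obtained from $w$ by deleting, for each letter, all but its $i$-th occurrence. For a word $u$, $s(u)$ and $l(u)$ denote its first and last letter. -}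

module Defs where

open import Data.Nat using (ℕ; zero; suc; _≟_)
open import Data.Fin as Fin using (Fin)
open import Data.List using (List; []; _∷_; filter)
open import Data.List.Membership.Propositional using (_∈_)
open import Data.Product using (_×_; ∃₂)
open import Data.Unit using (⊤)
open import Relation.Nullary using (¬_; yes; no)
open import Relation.Nullary.Decidable using (_⊎-dec_)
open import Relation.Binary.PropositionalEquality using (_≡_; _≢_)
open import Relation.Binary.Construct.Closure.ReflexiveTransitive using (Star)
open import Function.Bundles using (_⇔_)

occ : {n : ℕ} → Fin n → List (Fin n) → ℕ
occ x [] = 0
occ x (y ∷ w) with x Fin.≟ y
... | yes _ = suc (occ x w)
... | no  _ = occ x w

Uniform : {n : ℕ} → ℕ → List (Fin n) → Set
Uniform k w = ∀ x → occ x w ≡ k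

NoRepeatAdj : {n : ℕ} → List (Fin n) → Set
NoRepeatAdj [] = ⊤
NoRepeatAdj (x ∷ []) = ⊤
NoRepeatAdj (x ∷ y ∷ w) = x ≢ y × NoRepeatAdj (y ∷ w)

restrict : {n : ℕ} → Fin n → Fin n → List (Fin n) → List (Fin n)
restrict x y w = filter (λ z → (z Fin.≟ x) ⊎-dec (z Fin.≟ y)) w

-- x and y alternate in w: deleting all other letters leaves xyxy... or yxyx...,
-- i.e. the restricted word (over {x,y}) has no two equal adjacent letters
Alternate : {n : ℕ} → Fin n → Fin n → List (Fin n) → Set
Alternate x y w = NoRepeatAdj (restrict x y w)

Represents : {n : ℕ} → (Fin n → Fin n → Set) → List (Fin n) → Set
Represents {n} E w =
  (∀ (x : Fin n) → x ∈ w) ×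
  (∀ (x y : Fin n) → x ≢ y → (Alternate x y w ⇔ E x y))

IsSimple : {n : ℕ} → (Fin n → Fin n → Set) → Set
IsSimple {n} E = (∀ (x y : Fin n) → E x y → E y x) × (∀ (x : Fin n) → ¬ E x x)

Connected : {n : ℕ} → (Fin n → Fin n → Set) → Set
Connected {n} E = ∀ (x y : Fin n) → Star E x y

HasEdge : {n : ℕ} → (Fin n → Fin n → Set) → Set
HasEdge {n} E = ∃₂ λ (x y : Fin n) → E x y

-- i-th permutation (i ≥ 1): keep, for each letter, only its i-th occurrence.
-- `seen` is the already-read prefix.
permAux : {n : ℕ} → ℕ → List (Fin n) → List (Fin n) → List (Fin n)
permAux i seen [] = []
permAux i seen (x ∷ w) with suc (occ x seen) ≟ i
... | yes _ = x ∷ permAux i (x ∷ seen) w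
... | no  _ = permAux i (x ∷ seen) w

perm : {n : ℕ} → ℕ → List (Fin n) → List (Fin n)
perm i w = permAux i [] w

-- Every vertex x has a neighbour y, and x, y alternate in w. Along the prefixes of w the
-- counts of two alternating letters never differ by more than one, and the letter occurring
-- first is never behind; so x cannot be strictly ahead of y on one prefix and strictly behind
-- on another. Being the first letter of w or of P_j puts x strictly ahead of every other letter
-- just after that occurrence; being the last letter of w or of P_i leaves every other letter
-- strictly ahead of x just before it (for P_i: all other i-th occurrences come earlier).
module Submission where

open import Defs
open import Data.Nat using (ℕ; suc; _+_; _≤_; _<_; z≤n; s≤s)
import Data.Nat as ℕ
open import Data.Nat.Properties using (+-identityʳ; +-comm; +-suc; <⇒≱; ≮⇒≥; ≤∧≢⇒<; ≤-reflexive)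
open import Data.Fin as Fin using (Fin)
open import Data.List using (List; []; _∷_; _++_; head; last)
open import Data.List.Properties using (filter-++; filter-accept; filter-reject; ∷-injective)
open import Data.List.Relation.Unary.All as All using (All; _∷_)
open import Data.List.Relation.Unary.All.Properties using (all-filter)
open import Data.Maybe using (just)
open import Data.Product using (∃; ∃₂; _×_; _,_; proj₁)
open import Data.Sum using (_⊎_; inj₁; inj₂; swap)
open import Data.Empty using (⊥)
open import Relation.Nullary using (¬_; yes; no)
open import Relation.Nullary.Decidable using (_⊎-dec_)
open import Relation.Binary.PropositionalEquality
  using (_≡_; _≢_; refl; sym; trans; cong; subst; subst₂; ≢-sym; module ≡-Reasoning)
open import Relation.Binary.Construct.Closure.ReflexiveTransitive using (Star; ε; _◅_)
open import Function.Bundles using (Equivalence)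

module _ {A : Set} where

  last-just : {l : List A} → l ≢ [] → ∃ λ x → last l ≡ just x
  last-just {[]} l≢[] with () ← l≢[] refl
  last-just {x ∷ []} _ = x , refl
  last-just {_ ∷ y ∷ l} _ = last-just {y ∷ l} λ ()

  head-just : {l : List A} → l ≢ [] → ∃ λ x → head l ≡ just x
  head-just {[]} l≢[] with () ← l≢[] refl
  head-just {x ∷ _} _ = x , refl

  last≡just⇒∷ʳ : {l : List A} {x : A} → last l ≡ just x → ∃ λ u → l ≡ u ++ x ∷ []
  last≡just⇒∷ʳ {y ∷ []} refl = [] , refl
  last≡just⇒∷ʳ {y ∷ z ∷ l} h with u , e ← last≡just⇒∷ʳ {z ∷ l} h = y ∷ u , cong (y ∷_) e

module _ {n : ℕ} where

  occ-here : (x : Fin n) (u : List (Fin n)) → occ x (x ∷ u) ≡ suc (occ x u)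
  occ-here x u with x Fin.≟ x
  ... | yes _ = refl
  ... | no x≢x with () ← x≢x refl

  occ-there : {x z : Fin n} (u : List (Fin n)) → x ≢ z → occ x (z ∷ u) ≡ occ x u
  occ-there {x} {z} u x≢z with x Fin.≟ z
  ... | yes x≡z with () ← x≢z x≡z
  ... | no _ = refl

  occ-++ : (z : Fin n) (u v : List (Fin n)) → occ z (u ++ v) ≡ occ z u + occ z v
  occ-++ z [] v = refl
  occ-++ z (t ∷ u) v with z Fin.≟ t
  ... | yes _ = cong suc (occ-++ z u v)
  ... | no _ = occ-++ z u v

  occ-swap : (y z : Fin n) (s u : List (Fin n)) →
             occ y (z ∷ s) + occ y u ≡ occ y s + occ y (z ∷ u)
  occ-swap y z s u with y Fin.≟ z
  ... | yes _ = sym (+-suc (occ y s) (occ y u))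
  ... | no _ = refl

  -- x is strictly ahead of y on some prefix of w, counting the letters of s as already read.
  LeadsFrom : List (Fin n) → Fin n → Fin n → List (Fin n) → Set
  LeadsFrom s x y w = ∃₂ λ u r → w ≡ u ++ r × occ y s + occ y u < occ x s + occ x u

  Leads : Fin n → Fin n → List (Fin n) → Set
  Leads = LeadsFrom []

  LeadsFrom-∷ : ∀ {s x y z w} → LeadsFrom (z ∷ s) x y w → LeadsFrom s x y (z ∷ w)
  LeadsFrom-∷ {s} {x} {y} {z} (u , r , refl , lt) =
    z ∷ u , r , refl , subst₂ _<_ (occ-swap y z s u) (occ-swap x z s u) lt

  OverPair : Fin n → Fin n → List (Fin n) → Set
  OverPair a b = All (λ z → z ≡ a ⊎ z ≡ b)

  alternating-prefix-balance :
    ∀ {a b} L → a ≢ b → OverPair a b L → NoRepeatAdj (a ∷ L) →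
    ∀ p {q} → a ∷ L ≡ p ++ q → occ b p ≤ occ a p × occ a p ≤ suc (occ b p)
  alternating-prefix-balance _ _ _ _ [] _ = z≤n , z≤n
  alternating-prefix-balance {a} {b} [] a≢b _ _ (_ ∷ []) refl
    rewrite occ-here a [] | occ-there [] (≢-sym a≢b) = z≤n , s≤s z≤n
  alternating-prefix-balance [] _ _ _ (_ ∷ _ ∷ _) ()
  alternating-prefix-balance {a} {b} (c ∷ L) a≢b (c∈ab ∷ over) (a≢c , alt) (v ∷ p) eq
    with ∷-injective eq
  ... | refl , eq′ rewrite occ-here a p | occ-there p (≢-sym a≢b) with c∈ab
  ...   | inj₁ c≡a with () ← a≢c (sym c≡a)
  ...   | inj₂ refl
    with ih₁ , ih₂ ← alternating-prefix-balance L (≢-sym a≢b) (All.map swap over) alt p eq′ =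
    ih₂ , s≤s ih₁

  alternating⇒¬leads-both : ∀ {x y} R → x ≢ y → OverPair x y R → NoRepeatAdj R →
                            Leads x y R → Leads y x R → ⊥
  alternating⇒¬leads-both [] _ _ _ ([] , _ , _ , ()) _
  alternating⇒¬leads-both (_ ∷ L) x≢y (inj₁ refl ∷ over) alt _ (u , _ , e , lt) =
    <⇒≱ lt (proj₁ (alternating-prefix-balance L x≢y over alt u e))
  alternating⇒¬leads-both (_ ∷ L) x≢y (inj₂ refl ∷ over) alt (u , _ , e , lt) _ =
    <⇒≱ lt (proj₁ (alternating-prefix-balance L (≢-sym x≢y) (All.map swap over) alt u e))

  occ-restrict : ∀ {x y z} → z ≡ x ⊎ z ≡ y → (u : List (Fin n)) → occ z (restrict x y u) ≡ occ z u
  occ-restrict _ [] = refl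
  occ-restrict {x} {y} {z} z∈xy (v ∷ u) with (v Fin.≟ x) ⊎-dec (v Fin.≟ y)
  ... | yes v∈xy rewrite filter-accept (λ t → (t Fin.≟ x) ⊎-dec (t Fin.≟ y)) {v} {u} v∈xy
    with z Fin.≟ v
  ...   | yes _ = cong suc (occ-restrict z∈xy u)
  ...   | no _ = occ-restrict z∈xy u
  occ-restrict {x} {y} {z} z∈xy (v ∷ u) | no v∉xy
    rewrite filter-reject (λ t → (t Fin.≟ x) ⊎-dec (t Fin.≟ y)) {v} {u} v∉xy
          | occ-there u (λ z≡v → v∉xy (subst (λ t → t ≡ x ⊎ t ≡ y) z≡v z∈xy)) =
    occ-restrict z∈xy u

  leads-restrict : ∀ {x y a b w} → a ≡ x ⊎ a ≡ y → b ≡ x ⊎ b ≡ y →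
                   Leads a b w → Leads a b (restrict x y w)
  leads-restrict {x} {y} a∈xy b∈xy (u , r , refl , lt) =
    restrict x y u , restrict x y r , filter-++ _ u r ,
    subst₂ _<_ (sym (occ-restrict b∈xy u)) (sym (occ-restrict a∈xy u)) lt

  leads-both⇒¬alternate : ∀ {x y w} → x ≢ y → Leads x y w → Leads y x w → ¬ Alternate x y w
  leads-both⇒¬alternate {x} {y} {w} x≢y x-ahead y-ahead alt =
    alternating⇒¬leads-both (restrict x y w) x≢y (all-filter _ w) alt
      (leads-restrict (inj₁ refl) (inj₂ refl) x-ahead) (leads-restrict (inj₂ refl) (inj₁ refl) y-ahead)

  occ-∷-< : ∀ {i} y z (s : List (Fin n)) → occ y s < i → suc (occ z s) ≢ i → occ y (z ∷ s) < i
  occ-∷-< y z s lt skip with y Fin.≟ z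
  ... | yes refl = ≤∧≢⇒< lt skip
  ... | no _ = lt

  occ-shift-≤ : ∀ {i} y z (s w : List (Fin n)) →
                i ≤ occ y s + occ y (z ∷ w) → i ≤ occ y (z ∷ s) + occ y w
  occ-shift-≤ {i} y z s w = subst (i ≤_) (sym (occ-swap y z s w))

  permAux-nonempty : ∀ {i y} s w → occ y s < i → i ≤ occ y s + occ y w → permAux i s w ≢ []
  permAux-nonempty {i} {y} s [] lt tot _ =
    <⇒≱ lt (subst (i ≤_) (+-identityʳ (occ y s)) tot)
  permAux-nonempty {i} {y} s (z ∷ w) lt tot with suc (occ z s) ℕ.≟ i
  ... | yes _ = λ ()
  ... | no skip = permAux-nonempty (z ∷ s) w (occ-∷-< y z s lt skip) (occ-shift-≤ y z s w tot)

  permAux-head-leads : ∀ {i x y} s w → occ y s < i → y ≢ x →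
                       head (permAux i s w) ≡ just x → LeadsFrom s x y w
  permAux-head-leads {i} {y = y} s (z ∷ w) lt y≢x h with suc (occ z s) ℕ.≟ i
  permAux-head-leads {i} {y = y} s (z ∷ w) lt y≢x refl | yes chosen =
    z ∷ [] , w , refl , prefix-lt
    where
    prefix-lt : occ y s + occ y (z ∷ []) < occ z s + occ z (z ∷ [])
    prefix-lt rewrite occ-there [] y≢x | occ-here z [] | +-identityʳ (occ y s)
                    | +-comm (occ z s) 1 = subst (occ y s <_) (sym chosen) lt
  ... | no skip = LeadsFrom-∷ (permAux-head-leads (z ∷ s) w (occ-∷-< y z s lt skip) y≢x h)

  permAux-last-trails : ∀ {i x y} s w → i ≤ occ y s + occ y w → y ≢ x →
                        last (permAux i s w) ≡ just x → LeadsFrom s y x w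
  permAux-last-trails {i} {y = y} s (z ∷ w) tot y≢x h with suc (occ z s) ℕ.≟ i
  ... | no _ = LeadsFrom-∷ (permAux-last-trails (z ∷ s) w (occ-shift-≤ y z s w tot) y≢x h)
  ... | yes chosen with permAux i (z ∷ s) w in rest
  ...   | _ ∷ _ = LeadsFrom-∷
    (permAux-last-trails (z ∷ s) w (occ-shift-≤ y z s w tot) y≢x (trans (cong last rest) h))
  permAux-last-trails {i} {y = y} s (z ∷ w) tot y≢x refl | yes chosen | [] =
    [] , z ∷ w , refl ,
    subst₂ _<_ (sym (+-identityʳ (occ z s))) (sym (+-identityʳ (occ y s)))
      (subst (_≤ occ y s) (sym chosen) i≤occ-y)
    where
    -- if y had fewer than i occurrences before z, its i-th occurrence would follow z in P_i
    i≤occ-y : i ≤ occ y s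
    i≤occ-y = ≮⇒≥ λ lt → permAux-nonempty (z ∷ s) w
      (subst (_< i) (sym (occ-there s y≢x)) lt) (occ-shift-≤ y z s w tot) rest

  perm-head-leads : ∀ {i x y w} → 1 ≤ i → y ≢ x → head (perm i w) ≡ just x → Leads x y w
  perm-head-leads {w = w} 1≤i = permAux-head-leads [] w 1≤i

  head-leads : ∀ {x y w} → y ≢ x → head w ≡ just x → Leads x y w
  head-leads {x} {y} {_ ∷ w} y≢x refl = x ∷ [] , w , refl , prefix-lt
    where
    prefix-lt : occ y (x ∷ []) < occ x (x ∷ [])
    prefix-lt rewrite occ-there [] y≢x | occ-here x [] = s≤s z≤n

  module _ {k : ℕ} {w : List (Fin n)} (uniform : Uniform k w) where

    perm-nonempty : ∀ {i} → Fin n → 1 ≤ i → i ≤ k → perm i w ≢ []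
    perm-nonempty {i} a 1≤i i≤k =
      permAux-nonempty [] w 1≤i (subst (i ≤_) (sym (uniform a)) i≤k)

    perm-last-trails : ∀ {i x y} → i ≤ k → y ≢ x → last (perm i w) ≡ just x → Leads y x w
    perm-last-trails {i} {y = y} i≤k =
      permAux-last-trails [] w (subst (i ≤_) (sym (uniform y)) i≤k)

    last-trails : ∀ {x y} → y ≢ x → last w ≡ just x → Leads y x w
    last-trails {x} {y} y≢x h with u , w≡u∷ʳx ← last≡just⇒∷ʳ h =
      u , x ∷ [] , w≡u∷ʳx , ≤-reflexive (begin
        suc (occ x u)                 ≡⟨ +-comm 1 (occ x u) ⟩
        occ x u + 1                   ≡⟨ cong (occ x u +_) (sym (occ-here x [])) ⟩
        occ x u + occ x (x ∷ [])      ≡⟨ sym (occ-++ x u (x ∷ [])) ⟩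
        occ x (u ++ x ∷ [])           ≡⟨ cong (occ x) (sym w≡u∷ʳx) ⟩
        occ x w                       ≡⟨ trans (uniform x) (sym (uniform y)) ⟩
        occ y w                       ≡⟨ cong (occ y) w≡u∷ʳx ⟩
        occ y (u ++ x ∷ [])           ≡⟨ occ-++ y u (x ∷ []) ⟩
        occ y u + occ y (x ∷ [])      ≡⟨ cong (occ y u +_) (occ-there [] y≢x) ⟩
        occ y u + 0                   ≡⟨ +-identityʳ (occ y u) ⟩
        occ y u                       ∎)
      where open ≡-Reasoning

  star-first-step : ∀ {E : Fin n → Fin n → Set} {x t} → Star E x t → x ≢ t → ∃ (E x)
  star-first-step ε x≢x with () ← x≢x refl
  star-first-step (e ◅ _) _ = _ , e

  has-neighbour : ∀ {E : Fin n → Fin n → Set} → (∀ x → ¬ E x x) → Connected E → HasEdge E →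
                  ∀ x → ∃ (E x)
  has-neighbour irrefl connected (a , b , eab) x with x Fin.≟ a
  ... | yes refl = star-first-step (connected x b) λ { refl → irrefl x eab }
  ... | no x≢a = star-first-step (connected x a) x≢a

mainTheorem11 : (n : ℕ) (E : Fin n → Fin n → Set) → IsSimple E → Connected E → HasEdge E →
    (k : ℕ) (w : List (Fin n)) → Uniform k w → Represents E w →
    ((i j : ℕ) → 1 ≤ i → i ≤ k → 1 ≤ j → j ≤ k → i ≢ j →
      last (perm i w) ≢ head (perm j w)) ×
    ((i : ℕ) → 1 ≤ i → i ≤ k →
      (head w ≢ last (perm i w)) × (last w ≢ head (perm i w)))
mainTheorem11 n E (_ , irrefl) connected edge@(a , _) k w uniform (_ , alternate⇔E) =
  last-perm≢head-perm , λ i 1≤i i≤k → head≢last-perm 1≤i i≤k , last≢head-perm 1≤i i≤k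
  where
  clash : ∀ {x} → (∀ {y} → y ≢ x → Leads x y w) → (∀ {y} → y ≢ x → Leads y x w) → ⊥
  clash {x} x-ahead x-behind with y , exy ← has-neighbour irrefl connected edge x =
    leads-both⇒¬alternate x≢y (x-ahead (≢-sym x≢y)) (x-behind (≢-sym x≢y))
      (Equivalence.from (alternate⇔E x y x≢y) exy)
    where
    x≢y : x ≢ y
    x≢y refl = irrefl x exy

  nonempty : ∀ {i} → 1 ≤ i → i ≤ k → perm i w ≢ []
  nonempty = perm-nonempty {w = w} uniform a

  last-perm≢head-perm : (i j : ℕ) → 1 ≤ i → i ≤ k → 1 ≤ j → j ≤ k → i ≢ j →
                        last (perm i w) ≢ head (perm j w)
  last-perm≢head-perm i j 1≤i i≤k 1≤j _ _ eq with x , hx ← last-just (nonempty 1≤i i≤k) =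
    clash (λ y≢x → perm-head-leads 1≤j y≢x (trans (sym eq) hx))
          (λ y≢x → perm-last-trails uniform i≤k y≢x hx)

  head≢last-perm : ∀ {i} → 1 ≤ i → i ≤ k → head w ≢ last (perm i w)
  head≢last-perm 1≤i i≤k eq with x , hx ← last-just (nonempty 1≤i i≤k) =
    clash (λ y≢x → head-leads y≢x (trans eq hx))
          (λ y≢x → perm-last-trails uniform i≤k y≢x hx)

  last≢head-perm : ∀ {i} → 1 ≤ i → i ≤ k → last w ≢ head (perm i w)
  last≢head-perm 1≤i i≤k eq with x , hx ← head-just (nonempty 1≤i i≤k) =
    clash (λ y≢x → perm-head-leads 1≤i y≢x hx)
          (λ y≢x → last-trails uniform y≢x (trans eq hx))
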